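{- Let $\mathbf A=\langle A,\land,\lor,*,\Rightarrow,1\rangle$ be a commutative integral residuated lattice whose doubling $\mathbf A^*$ is an $\mathcal S$-algebra (equivalently, a three-potent involutive bounded commutative integral residuated lattice). Then: (1) $\mathbf A^*$ is an $\mathcal N3$-lattice if and only if $\mathbf A$ is an implicative lattice; (2) $\mathbf A^*$ is an MV-algebra if and only if $\mathbf A$ is trivial (equivalently, if and only if $\mathbf A^*$ is the two-element Boolean algebra).
   Context: A commutative integral residuated lattice (CIRL) is an algebra $\langle A,\land,\lor,*,\Rightarrow,1\rangle$ such that $\langle A,\land,\lor\rangle$ is a lattice with top element $1$, $\langle A,*,1\rangle$ is a commutative monoid, and $a*b\le c$ iff $b\le a\Rightarrow c$. An implicative lattice is a CIRL in which $*$ coincides with $\land$. A bounded CIRL has an extra constant $0$ that is the least element; set $\neg a:=a\Rightarrow0$; it is involutive if $\neg\neg x\approx x$; three-potent means $a*a\le a*a*a$. Doubling: given a CIRL $\mathbf A$, let $\neg A=\{\neg a:a\in A\}$ be a disjoint copy of $A$ and $A^*=A\cup\neg A$. Order $A^*$ by: for $a,b\in A$, $a\le b$ iff $a\le_A b$; $\neg a\le b$ always; $\neg a\le\neg b$ iff $b\le_A a$ (and $a\not\le\neg b$). Set $\neg(\neg a):=a$; on $A$ the operations are those of $\mathbf A$; $\neg a\land\neg b:=\neg(a\lor b)$, $\neg a\lor\neg b:=\neg(a\land b)$ (mixed meets/joins are determined by the order); $a*\neg b=\neg b*a:=\neg(a\Rightarrow b)$, $\neg a*\neg b:=\neg1$;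 $a\Rightarrow\neg b:=\neg(a*b)$, $\neg a\Rightarrow\neg b:=b\Rightarrow a$, $\neg a\Rightarrow b:=1$; the constants are $1$ and $0:=\neg 1$. Then $\mathbf A^*=\langle A^*,\land,\lor,*,\Rightarrow,\neg,0,1\rangle$. $\mathcal N3$-lattices (Nelson algebras), presented in this signature with the strong implication $\Rightarrow$, are exactly the three-potent involutive bounded CIRLs satisfying $((x^2\Rightarrow y)\land((\neg y)^2\Rightarrow\neg x))\Rightarrow(x\Rightarrow y)\approx1$, where $z^2:=z*z$. MV-algebras, in this signature, are the involutive bounded CIRLs satisfying $x*(x\Rightarrow y)\approx x\land y$ and $(x\Rightarrow y)\lor(y\Rightarrow x)\approx1$. -}

module Defs where

open import Data.Sum using (_⊎_; inj₁; inj₂)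
open import Data.Product using (_×_)
open import Function.Bundles using (_⇔_)
open import Relation.Binary.PropositionalEquality using (_≡_)
open import Algebra.Lattice.Structures using (IsLattice)
open import Algebra.Structures using (IsCommutativeMonoid)

record RawCIRL : Set₁ where
  field
    Carrier : Set
    _∧_ _∨_ _*_ _⇒_ : Carrier → Carrier → Carrier
    one : Carrier

  infixr 6 _∧_ _∨_
  infixr 5 _⇒_
  infixl 7 _*_
  infix 4 _≤_

  _≤_ : Carrier → Carrier → Set
  a ≤ b = a ∧ b ≡ a

record IsCIRL (R : RawCIRL) : Set where
  open RawCIRL R
  field
    isLattice : IsLattice _≡_ _∨_ _∧_
    top : ∀ a → a ≤ one
    isCommutativeMonoid : IsCommutativeMonoid _≡_ _*_ one
    residuation : ∀ a b c → (a * b ≤ c) ⇔ (b ≤ (a ⇒ c))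

record CIRL : Set₁ where
  field
    raw : RawCIRL
    isCIRL : IsCIRL raw
  open RawCIRL raw public

record RawBCIRL : Set₁ where
  field
    raw : RawCIRL
    zero : RawCIRL.Carrier raw
  open RawCIRL raw public

  ¬_ : Carrier → Carrier
  ¬ a = a ⇒ zero

  infix 8 ¬_
  infix 9 _²

  _² : Carrier → Carrier
  a ² = a * a

module _ (B : RawBCIRL) where
  open RawBCIRL B

  IsBoundedCIRL : Set
  IsBoundedCIRL = IsCIRL raw × (∀ a → zero ≤ a)

  IsInvolutive : Set
  IsInvolutive = ∀ a → ¬ (¬ a) ≡ a

  IsThreePotent : Set
  IsThreePotent = ∀ a → (a * a) ≤ (a * a * a)

  IsSAlgebra : Set
  IsSAlgebra = IsBoundedCIRL × IsInvolutive × IsThreePotent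

  IsN3Lattice : Set
  IsN3Lattice = IsSAlgebra ×
    (∀ x y → ((x ² ⇒ y) ∧ ((¬ y) ² ⇒ ¬ x)) ⇒ (x ⇒ y) ≡ one)

  IsMVAlgebra : Set
  IsMVAlgebra = IsBoundedCIRL × IsInvolutive ×
    (∀ x y → x * (x ⇒ y) ≡ x ∧ y) × (∀ x y → (x ⇒ y) ∨ (y ⇒ x) ≡ one)

IsImplicativeLattice : CIRL → Set
IsImplicativeLattice A = (a b : Carrier) → a * b ≡ a ∧ b
  where open CIRL A

IsTrivial : CIRL → Set
IsTrivial A = (a b : Carrier) → a ≡ b
  where open CIRL A

-- The doubling A*: carrier A ⊎ A, inj₁ a = a, inj₂ a = ¬a.
module Doubling (A : CIRL) where
  open CIRL A renaming (_∧_ to _∧ᴬ_; _∨_ to _∨ᴬ_; _*_ to _*ᴬ_; _⇒_ to _⇒ᴬ_)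

  D : Set
  D = Carrier ⊎ Carrier

  _∧ᴰ_ : D → D → D
  inj₁ a ∧ᴰ inj₁ b = inj₁ (a ∧ᴬ b)
  inj₁ a ∧ᴰ inj₂ b = inj₂ b
  inj₂ a ∧ᴰ inj₁ b = inj₂ a
  inj₂ a ∧ᴰ inj₂ b = inj₂ (a ∨ᴬ b)

  _∨ᴰ_ : D → D → D
  inj₁ a ∨ᴰ inj₁ b = inj₁ (a ∨ᴬ b)
  inj₁ a ∨ᴰ inj₂ b = inj₁ a
  inj₂ a ∨ᴰ inj₁ b = inj₁ b
  inj₂ a ∨ᴰ inj₂ b = inj₂ (a ∧ᴬ b)

  _*ᴰ_ : D → D → D
  inj₁ a *ᴰ inj₁ b = inj₁ (a *ᴬ b)
  inj₁ a *ᴰ inj₂ b = inj₂ (a ⇒ᴬ b)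
  inj₂ a *ᴰ inj₁ b = inj₂ (b ⇒ᴬ a)
  inj₂ a *ᴰ inj₂ b = inj₂ one

  _⇒ᴰ_ : D → D → D
  inj₁ a ⇒ᴰ inj₁ b = inj₁ (a ⇒ᴬ b)
  inj₁ a ⇒ᴰ inj₂ b = inj₂ (a *ᴬ b)
  inj₂ a ⇒ᴰ inj₁ b = inj₁ one
  inj₂ a ⇒ᴰ inj₂ b = inj₁ (b ⇒ᴬ a)

  double : RawBCIRL
  double = record
    { raw = record
      { Carrier = D ; _∧_ = _∧ᴰ_ ; _∨_ = _∨ᴰ_ ; _*_ = _*ᴰ_ ; _⇒_ = _⇒ᴰ_
      ; one = inj₁ one }
    ; zero = inj₂ one }

_* : CIRL → RawBCIRL
A * = Doubling.double A

module Submission where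

-- (1) Evaluating the Nelson identity of A* at x = a, y = a * a gives a ⇒ a * a = 1,
--     i.e. a ≤ a², so A is implicative.  Conversely, if A is implicative then
--     every positive element of A* is *-idempotent; for a positive x the Nelson
--     term is ((x ⇒ y) ∧ q) ⇒ (x ⇒ y), for a negative x and positive y the
--     consequent x ⇒ y is 1, and for both negative it is (p ∧ (x ⇒ y)) ⇒ (x ⇒ y).
-- (2) Evaluating the MV law x * (x ⇒ y) = x ∧ y of A* at x = b², y = ¬b gives
--     b = b² ⇒ b³, which is 1 by three-potency, so A is trivial.  Conversely, if
--     A is trivial then A* has exactly the two elements 1 and ¬1 and the MV laws
--     hold by inspection.

open import Defs
open import Data.Product using (_×_; _,_; proj₁)
open import Data.Sum using (inj₁; inj₂)
open import Data.Sum.Properties using (inj₁-injective; inj₂-injective)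
open import Function.Bundles using (_⇔_; mk⇔; module Equivalence)
open import Relation.Binary.PropositionalEquality
open import Algebra.Lattice.Bundles using (Lattice)
open import Algebra.Structures using (module IsCommutativeMonoid)
import Algebra.Lattice.Properties.Lattice as LatticeProperties
import Relation.Binary.Lattice as OrderTheoretic

open Equivalence using (to; from)

module ResiduatedLattice (A : CIRL) where
  open CIRL A
  open IsCIRL isCIRL

  private
    module M = IsCommutativeMonoid isCommutativeMonoid

    lattice : Lattice _ _
    lattice = record
      { Carrier = Carrier ; _≈_ = _≡_ ; _∨_ = _∨_ ; _∧_ = _∧_ ; isLattice = isLattice }

    -- The library's order on a lattice is x ≈ x ∧ y, the symmetric form of ours.
    module Order =
      OrderTheoretic.Lattice (LatticeProperties.∨-∧-orderTheoreticLattice lattice)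

  open LatticeProperties lattice public using (∧-idem)

  ≤-refl : ∀ {x} → x ≤ x
  ≤-refl = sym Order.refl

  ≤-trans : ∀ {x y z} → x ≤ y → y ≤ z → x ≤ z
  ≤-trans p q = sym (Order.trans (sym p) (sym q))

  ≤-antisym : ∀ {x y} → x ≤ y → y ≤ x → x ≡ y
  ≤-antisym p q = Order.antisym (sym p) (sym q)

  ∧-greatest : ∀ {x y z} → x ≤ y → x ≤ z → x ≤ y ∧ z
  ∧-greatest p q = sym (Order.∧-greatest (sym p) (sym q))

  x∧y≤x : ∀ x y → x ∧ y ≤ x
  x∧y≤x x y = sym (Order.x∧y≤x x y)

  x∧y≤y : ∀ x y → x ∧ y ≤ y
  x∧y≤y x y = sym (Order.x∧y≤y x y)

  ≤→⇒≡one : ∀ {x y} → x ≤ y → x ⇒ y ≡ one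
  ≤→⇒≡one {x} {y} x≤y =
    ≤-antisym (top (x ⇒ y)) (to (residuation x one y) (subst (_≤ y) (sym (M.identityʳ x)) x≤y))

  ⇒≡one→≤ : ∀ {x y} → x ⇒ y ≡ one → x ≤ y
  ⇒≡one→≤ {x} {y} x⇒y≡one = subst (_≤ y) (M.identityʳ x)
    (from (residuation x one y) (subst (one ≤_) (sym x⇒y≡one) ≤-refl))

  x⇒one : ∀ x → x ⇒ one ≡ one
  x⇒one x = ≤→⇒≡one (top x)

  one⇒x : ∀ x → one ⇒ x ≡ x
  one⇒x x = ≤-antisym
    (subst (_≤ x) (M.identityˡ (one ⇒ x)) (from (residuation one (one ⇒ x) x) ≤-refl))
    (to (residuation one x x) (subst (_≤ x) (sym (M.identityˡ x)) ≤-refl))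

  ∧⇒ˡ : ∀ x y → (x ∧ y) ⇒ x ≡ one
  ∧⇒ˡ x y = ≤→⇒≡one (x∧y≤x x y)

  ∧⇒ʳ : ∀ x y → (x ∧ y) ⇒ y ≡ one
  ∧⇒ʳ x y = ≤→⇒≡one (x∧y≤y x y)

  *-monoˡ : ∀ {x y} z → x ≤ y → x * z ≤ y * z
  *-monoˡ {x} {y} z x≤y = subst (_≤ y * z) (M.comm z x)
    (from (residuation z x (y * z))
      (≤-trans x≤y (to (residuation z y (y * z)) (subst (_≤ y * z) (M.comm y z) ≤-refl))))

  *-mono : ∀ {x y u v} → x ≤ y → u ≤ v → x * u ≤ y * v
  *-mono {x} {y} {u} {v} x≤y u≤v = ≤-trans (*-monoˡ u x≤y)
    (subst₂ _≤_ (M.comm u y) (M.comm v y) (*-monoˡ y u≤v))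

  x*y≤x : ∀ x y → x * y ≤ x
  x*y≤x x y = subst (x * y ≤_) (M.identityʳ x) (*-mono (≤-refl {x}) (top y))

  x*y≤y : ∀ x y → x * y ≤ y
  x*y≤y x y = subst (_≤ y) (M.comm y x) (x*y≤x y x)

  square-increasing→implicative : (∀ a → a ≤ a * a) → IsImplicativeLattice A
  square-increasing→implicative a≤a² a b = ≤-antisym
    (∧-greatest (x*y≤x a b) (x*y≤y a b))
    (≤-trans (a≤a² (a ∧ b)) (*-mono (x∧y≤x a b) (x∧y≤y a b)))

  implicative→idempotent : IsImplicativeLattice A → ∀ a → a * a ≡ a
  implicative→idempotent *≡∧ a = trans (*≡∧ a a) (∧-idem a)

nelson : (B : RawBCIRL) → RawBCIRL.Carrier B → RawBCIRL.Carrier B → RawBCIRL.Carrier B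
nelson B x y = ((x ² ⇒ y) ∧ ((¬ y) ² ⇒ ¬ x)) ⇒ (x ⇒ y)
  where open RawBCIRL B

underlyingCIRL : (B : RawBCIRL) → IsBoundedCIRL B → CIRL
underlyingCIRL B bounded = record { raw = RawBCIRL.raw B ; isCIRL = proj₁ bounded }

module Doubled (A : CIRL) where
  open CIRL A
  open ResiduatedLattice A
  open RawBCIRL (A *) using (¬_; _²)
    renaming (Carrier to D; _∧_ to _∧*_; _∨_ to _∨*_; _*_ to _**_; _⇒_ to _⇒*_; one to one*)

  three-potent-base : IsThreePotent (A *) → ∀ a → a * a ≤ a * a * a
  three-potent-base threePotent a = inj₁-injective (threePotent (inj₁ a))

  -- The Nelson term at x = a, y = a² reduces to a ⇒ a²: its antecedent is
  -- (a² ⇒ a²) ∧ (¬1 ⇒ ¬a) = 1 ∧ 1, since (¬y)² = ¬1 for every positive y.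
  nelson-at-square : ∀ a → nelson (A *) (inj₁ a) (inj₁ (a * a)) ≡ inj₁ (a ⇒ a * a)
  nelson-at-square a = cong inj₁ (begin
    ((a * a ⇒ a * a) ∧ (a * one ⇒ one)) ⇒ (a ⇒ a * a)
      ≡⟨ cong (λ t → t ⇒ (a ⇒ a * a)) (cong₂ _∧_ (≤→⇒≡one ≤-refl) (x⇒one (a * one))) ⟩
    (one ∧ one) ⇒ (a ⇒ a * a)
      ≡⟨ cong (_⇒ (a ⇒ a * a)) (∧-idem one) ⟩
    one ⇒ (a ⇒ a * a)
      ≡⟨ one⇒x (a ⇒ a * a) ⟩
    a ⇒ a * a ∎)
    where open ≡-Reasoning

  nelson→implicative : (∀ x y → nelson (A *) x y ≡ one*) → IsImplicativeLattice A
  nelson→implicative nelson≡one = square-increasing→implicative λ a →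
    ⇒≡one→≤ (inj₁-injective
      (trans (sym (nelson-at-square a)) (nelson≡one (inj₁ a) (inj₁ (a * a)))))

  implicative→nelson : IsBoundedCIRL (A *) → IsImplicativeLattice A →
                       ∀ x y → nelson (A *) x y ≡ one*
  implicative→nelson bounded implicative = nelson≡one
    where
    open ResiduatedLattice (underlyingCIRL (A *) bounded)
      using () renaming (∧⇒ˡ to ∧⇒ˡ*; ∧⇒ʳ to ∧⇒ʳ*; x⇒one to x⇒one*)

    idem : ∀ a → a * a ≡ a
    idem = implicative→idempotent implicative

    nelson≡one : ∀ x y → nelson (A *) x y ≡ one*
    -- a positive antecedent is idempotent, so the Nelson term is ((x ⇒ y) ∧ q) ⇒ (x ⇒ y)
    nelson≡one (inj₁ a) y =
      subst (λ t → ((t ⇒* y) ∧* q) ⇒* (inj₁ a ⇒* y) ≡ one*) (sym (cong inj₁ (idem a)))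
        (∧⇒ˡ* (inj₁ a ⇒* y) q)
      where
      q : D
      q = (¬ y) ² ⇒* ¬ inj₁ a
    -- a negative element implies every positive one
    nelson≡one (inj₂ a) (inj₁ b) =
      x⇒one* ((inj₂ a ² ⇒* inj₁ b) ∧* ((¬ inj₁ b) ² ⇒* ¬ inj₂ a))
    -- for y = ¬b, ¬y is positive hence idempotent, and ¬y ⇒ ¬x equals x ⇒ y
    nelson≡one (inj₂ a) (inj₂ b) =
      subst (λ t → (p ∧* t) ⇒* inj₁ (b ⇒ a) ≡ one*) (sym contraposed)
        (∧⇒ʳ* p (inj₁ (b ⇒ a)))
      where
      p : D
      p = inj₂ a ² ⇒* inj₂ b

      contraposed : inj₁ ((one ⇒ b) * (one ⇒ b) ⇒ (one ⇒ a)) ≡ inj₁ (b ⇒ a)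
      contraposed = cong inj₁ (cong₂ _⇒_ (trans (idem (one ⇒ b)) (one⇒x b)) (one⇒x a))

  -- (2, ⇒): the MV law x * (x ⇒ y) = x ∧ y at x = b², y = ¬b gives b = b² ⇒ b³,
  -- which is 1 by three-potency.
  divisibility→trivial : IsThreePotent (A *) →
                         (∀ x y → x ** (x ⇒* y) ≡ x ∧* y) → IsTrivial A
  divisibility→trivial threePotent divisible a b = trans (≡one a) (sym (≡one b))
    where
    ≡one : ∀ c → c ≡ one
    ≡one c = trans (sym (inj₂-injective (divisible (inj₁ (c * c)) (inj₂ c))))
                   (≤→⇒≡one (three-potent-base threePotent c))

  -- (2, ⇐): over a trivial A, the doubling has only the elements 1 and ¬1, and
  -- two elements of A* of the same sign are equal.
  module OverTrivial (trivial : IsTrivial A) where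
    divisibility : ∀ x y → x ** (x ⇒* y) ≡ x ∧* y
    divisibility (inj₁ a) (inj₁ b) = cong inj₁ (trivial _ _)
    divisibility (inj₁ a) (inj₂ b) = cong inj₂ (trivial _ _)
    divisibility (inj₂ a) (inj₁ b) = cong inj₂ (trivial _ _)
    divisibility (inj₂ a) (inj₂ b) = cong inj₂ (trivial _ _)

    prelinearity : ∀ x y → (x ⇒* y) ∨* (y ⇒* x) ≡ one*
    prelinearity (inj₁ a) (inj₁ b) = cong inj₁ (trivial _ _)
    prelinearity (inj₁ a) (inj₂ b) = refl
    prelinearity (inj₂ a) (inj₁ b) = cong inj₁ (trivial _ _)
    prelinearity (inj₂ a) (inj₂ b) = cong inj₁ (trivial _ _)

proposition6p8 : (A : CIRL) → IsSAlgebra (A *) →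
    (IsN3Lattice (A *) ⇔ IsImplicativeLattice A) × (IsMVAlgebra (A *) ⇔ IsTrivial A)
proposition6p8 A S@(bounded , involutive , threePotent) =
  mk⇔ (λ (_ , nelson≡one) → nelson→implicative nelson≡one)
      (λ implicative → S , implicative→nelson bounded implicative)
  , mk⇔ (λ (_ , _ , divisible , _) → divisibility→trivial threePotent divisible)
        (λ trivial → bounded , involutive , OverTrivial.divisibility trivial
                   , OverTrivial.prelinearity trivial)
  where open Doubled A
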